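{- Let $X$ be a connected, locally finite graph and suppose $\Gamma\le\mathrm{AUT}(X)$ acts quasi-transitively on $X$. Then for any block $B$ of $X$, the set-wise stabilizer $\Gamma_B=\{\gamma\in\Gamma:\gamma B=B\}$ acts quasi-transitively on $B$.
   Context: A block of $X$ is a maximal connected subgraph of $X$ containing no cutvertex (of itself). Quasi-transitive means finitely many orbits on the vertex set. -}

module Defs where

open import Level using (0ℓ)
open import Data.Product using (Σ; ∃; _×_; _,_)
open import Data.List using (List)
open import Data.List.Membership.Propositional using (_∈_)
open import Relation.Nullary using (¬_)
open import Relation.Binary.PropositionalEquality using (_≡_; _≢_)
open import Function.Bundles using (_⇔_)

record Graph : Set₁ where
  field
    V      : Set
    _~_    : V → V → Set
    ~-sym  : ∀ {u v} → u ~ v → v ~ u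
    ~-irr  : ∀ {v} → ¬ (v ~ v)

module _ (X : Graph) where
  open Graph X

  LocallyFinite : Set
  LocallyFinite = ∀ v → Σ (List V) λ ns → ∀ w → v ~ w → w ∈ ns

  record Subgraph : Set₁ where
    field
      inV    : V → Set
      inE    : V → V → Set
      E⊆~    : ∀ {u w} → inE u w → u ~ w
      E-sym  : ∀ {u w} → inE u w → inE w u
      E⇒V    : ∀ {u w} → inE u w → inV u
  open Subgraph public

  _⊆_ : Subgraph → Subgraph → Set
  H ⊆ K = (∀ v → inV H v → inV K v) × (∀ u w → inE H u w → inE K u w)

  data Walk (H : Subgraph) : V → V → Set where
    [] : ∀ {a} → inV H a → Walk H a a
    _∷_ : ∀ {a c b} → inE H a c → Walk H c b → Walk H a b

  Connected : Subgraph → Set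
  Connected H = (∃ λ v → inV H v) × (∀ a b → inV H a → inV H b → Walk H a b)

  delete : Subgraph → V → Subgraph
  delete H v = record
    { inV   = λ u → inV H u × u ≢ v
    ; inE   = λ u w → inE H u w × u ≢ v × w ≢ v
    ; E⊆~   = λ { (e , _ , _) → E⊆~ H e }
    ; E-sym = λ { (e , p , q) → E-sym H e , q , p }
    ; E⇒V   = λ { (e , p , _) → E⇒V H e , p }
    }

  IsCutvertex : Subgraph → V → Set
  IsCutvertex H v = inV H v × (∃ λ a → ∃ λ b →
    inV (delete H v) a × inV (delete H v) b × ¬ Walk (delete H v) a b)

  NoCutvertex : Subgraph → Set
  NoCutvertex H = ∀ v → ¬ IsCutvertex H v

  IsBlock : Subgraph → Set₁
  IsBlock B = Connected B × NoCutvertex B ×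
    (∀ H → B ⊆ H → Connected H → NoCutvertex H → H ⊆ B)

  record Aut : Set where
    field
      to      : V → V
      from    : V → V
      to-from : ∀ v → to (from v) ≡ v
      from-to : ∀ v → from (to v) ≡ v
      adj     : ∀ u w → (u ~ w) ⇔ (to u ~ to w)
  open Aut public

  idAut : Aut
  idAut = record
    { to = λ v → v ; from = λ v → v
    ; to-from = λ _ → Relation.Binary.PropositionalEquality.refl
    ; from-to = λ _ → Relation.Binary.PropositionalEquality.refl
    ; adj = λ u w → Function.Bundles.mk⇔ (λ x → x) (λ x → x) }

  _∘A_ : Aut → Aut → Aut
  g ∘A h = record
    { to = λ v → to g (to h v) ; from = λ v → from h (from g v)
    ; to-from = λ v → Relation.Binary.PropositionalEquality.trans
        (Relation.Binary.PropositionalEquality.cong (to g) (to-from h (from g v))) (to-from g v)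
    ; from-to = λ v → Relation.Binary.PropositionalEquality.trans
        (Relation.Binary.PropositionalEquality.cong (from h) (from-to g (to h v))) (from-to h v)
    ; adj = λ u w → Function.Bundles.mk⇔
        (λ x → Function.Bundles.Equivalence.to (adj g (to h u) (to h w))
                 (Function.Bundles.Equivalence.to (adj h u w) x))
        (λ x → Function.Bundles.Equivalence.from (adj h u w)
                 (Function.Bundles.Equivalence.from (adj g (to h u) (to h w)) x)) }

  invAut : Aut → Aut
  invAut g = record
    { to = from g ; from = to g ; to-from = from-to g ; from-to = to-from g
    ; adj = λ u w → Function.Bundles.mk⇔
        (λ x → Function.Bundles.Equivalence.from (adj g (from g u) (from g w))
          (Relation.Binary.PropositionalEquality.subst₂ _~_
            (Relation.Binary.PropositionalEquality.sym (to-from g u))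
            (Relation.Binary.PropositionalEquality.sym (to-from g w)) x))
        (λ x → Relation.Binary.PropositionalEquality.subst₂ _~_ (to-from g u) (to-from g w)
          (Function.Bundles.Equivalence.to (adj g (from g u) (from g w)) x)) }

  record IsSubgroup (Γ : Aut → Set) : Set where
    field
      id-closed  : Γ idAut
      ∘-closed   : ∀ {g h} → Γ g → Γ h → Γ (g ∘A h)
      inv-closed : ∀ {g} → Γ g → Γ (invAut g)

  -- a set G of automorphisms acts quasi-transitively on the vertex set S:
  -- finitely many G-orbits on S (a finite list of representatives in S)
  QuasiTransitiveOn : (Aut → Set) → (V → Set) → Set
  QuasiTransitiveOn G S = Σ (List V) λ reps →
    (∀ r → r ∈ reps → S r) ×
    (∀ v → S v → ∃ λ r → r ∈ reps × ∃ λ g → G g × to g r ≡ v)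

  Stabilizes : Aut → Subgraph → Set
  Stabilizes g B = (∀ v → inV B v ⇔ inV B (to g v)) ×
                   (∀ u w → inE B u w ⇔ inE B (to g u) (to g w))

  AllV : V → Set
  AllV _ = Data.Unit.⊤
    where import Data.Unit

  wholeGraph : Subgraph
  wholeGraph = record { inV = λ _ → Data.Unit.⊤ ; inE = _~_ ; E⊆~ = λ e → e ; E-sym = ~-sym ; E⇒V = λ _ → Data.Unit.tt }
    where import Data.Unit

  ConnectedGraph : Set
  ConnectedGraph = Connected wholeGraph

module Submission where

-- An automorphism γ carrying a single edge of a block B into B stabilises B: B and γB are
-- both 2-connected and share the two ends of that edge, so B ∪ γB is connected without a
-- cutvertex and maximality of B gives γB ⊆ B; the same argument for γ⁻¹ gives equality.
-- Hence, choosing for every Γ-orbit representative r and every neighbour w of r one γ ∈ Γ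
-- with γr γw an edge of B (if there is one), the finitely many vertices γr meet every
-- Γ_B-orbit of B. A block without edges is a single vertex.

open import Defs
open import Level using (0ℓ; lift)
open import Data.Product using (_×_; ∃; _,_; proj₁; proj₂)
open import Data.Sum using (_⊎_; inj₁; inj₂)
open import Data.Empty using (⊥)
open import Data.Unit using (tt)
open import Data.List using (List; []; _∷_; concatMap)
open import Data.List.Membership.Propositional using (_∈_; find; lose)
open import Data.List.Membership.Propositional.Properties using (∈-concatMap⁺; ∈-concatMap⁻)
open import Data.List.Relation.Unary.Any using (here)
open import Relation.Nullary using (¬_; Dec; yes; no)
open import Relation.Nullary.Negation using (¬¬-map)
open import Relation.Nullary.Decidable using (¬¬-excluded-middle)
open import Relation.Binary.PropositionalEquality using (_≡_; _≢_; refl; sym; trans; cong; subst; subst₂)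
open import Function.Base using (_∘_)
open import Function.Bundles using (mk⇔; Equivalence)
open import Axiom.ExcludedMiddle using (ExcludedMiddle)

module _ (X : Graph) where
  open Graph X

  Walk-map : {H K : Subgraph X} (f : V → V) →
             (∀ v → inV H v → inV K (f v)) → (∀ u w → inE H u w → inE K (f u) (f w)) →
             ∀ {a b} → Walk X H a b → Walk X K (f a) (f b)
  Walk-map f fV fE ([] a∈H) = [] (fV _ a∈H)
  Walk-map f fV fE (e ∷ p)  = fE _ _ e ∷ Walk-map f fV fE p

  Walk-mono : {H K : Subgraph X} → _⊆_ X H K → ∀ {a b} → Walk X H a b → Walk X K a b
  Walk-mono (H⊆K-V , H⊆K-E) = Walk-map (λ v → v) H⊆K-V H⊆K-E

  Walk-++ : {H : Subgraph X} {a b c : V} → Walk X H a b → Walk X H b c → Walk X H a c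
  Walk-++ ([] _)  q = q
  Walk-++ (e ∷ p) q = e ∷ Walk-++ p q

  Walk-reverse : {H : Subgraph X} {a b : V} → Walk X H a b → Walk X H b a
  Walk-reverse ([] a∈H)    = [] a∈H
  Walk-reverse {H} (e ∷ p) = Walk-++ (Walk-reverse p) (E-sym H e ∷ [] (E⇒V H e))

  Walk-edgeless⇒≡ : {H : Subgraph X} → (∀ u w → ¬ inE H u w) → ∀ {a b} → Walk X H a b → a ≡ b
  Walk-edgeless⇒≡ edgeless ([] _)  = refl
  Walk-edgeless⇒≡ edgeless (e ∷ _) with () ← edgeless _ _ e

  Walk-to-edge⇒edge : {H : Subgraph X} {v a b : V} → Walk X H v a → inE H a b → ∃ λ u → inE H v u
  Walk-to-edge⇒edge ([] _)  e = _ , e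
  Walk-to-edge⇒edge (e ∷ _) _ = _ , e

  adjacent⇒≢ : ∀ {u w} → u ~ w → u ≢ w
  adjacent⇒≢ u~w refl = ~-irr u~w

  delete-mono : {H K : Subgraph X} → _⊆_ X H K → ∀ x → _⊆_ X (delete X H x) (delete X K x)
  delete-mono (H⊆K-V , H⊆K-E) x =
    (λ v (v∈H , v≢x) → H⊆K-V v v∈H , v≢x) ,
    (λ u w (e , u≢x , w≢x) → H⊆K-E u w e , u≢x , w≢x)

  ⊆-delete-nonvertex : (H : Subgraph X) {x : V} → ¬ inV H x → _⊆_ X H (delete X H x)
  ⊆-delete-nonvertex H x∉H =
    (λ v v∈H → v∈H , ≢x v∈H) ,
    (λ u w e → e , ≢x (E⇒V H e) , ≢x (E⇒V H (E-sym H e)))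
    where
    ≢x : ∀ {v} → inV H v → v ≢ _
    ≢x v∈H refl = x∉H v∈H

  -- The avoidance clause quantifies over every x, also x outside C, so that it can be
  -- used for a union without deciding which part contains x.
  NonSeparable : Subgraph X → Set
  NonSeparable C =
    (∀ a b → inV C a → inV C b → Walk X C a b) ×
    (∀ x a b → inV C a → inV C b → a ≢ x → b ≢ x → ¬ ¬ Walk X (delete X C x) a b)

  block⇒nonSeparable : (B : Subgraph X) → IsBlock X B → NonSeparable B
  block⇒nonSeparable B ((_ , walk) , noCutvertex , _) = walk , avoid
    where
    avoid : ∀ x a b → inV B a → inV B b → a ≢ x → b ≢ x → ¬ ¬ Walk X (delete X B x) a b
    avoid x a b a∈B b∈B a≢x b≢x ¬walk = ¬¬-excluded-middle λ
      { (yes x∈B) → noCutvertex x (x∈B , a , b , (a∈B , a≢x) , (b∈B , b≢x) , ¬walk)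
      ; (no x∉B)  → ¬walk (Walk-mono (⊆-delete-nonvertex B x∉B) (walk a b a∈B b∈B))
      }

  image : Aut X → Subgraph X → Subgraph X
  image g C = record
    { inV   = λ v → inV C (from g v)
    ; inE   = λ u w → inE C (from g u) (from g w)
    ; E⊆~   = λ {u} {w} e → subst₂ _~_ (to-from g u) (to-from g w)
                (Equivalence.to (adj g (from g u) (from g w)) (E⊆~ C e))
    ; E-sym = E-sym C
    ; E⇒V   = E⇒V C
    }

  from-injective : (g : Aut X) → ∀ {a b} → from g a ≡ from g b → a ≡ b
  from-injective g {a} {b} eq = trans (sym (to-from g a)) (trans (cong (to g) eq) (to-from g b))

  Walk-image : (g : Aut X) (C : Subgraph X) →
               ∀ {a b} → Walk X C (from g a) (from g b) → Walk X (image g C) a b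
  Walk-image g C {a} {b} p = subst₂ (Walk X (image g C)) (to-from g a) (to-from g b)
    (Walk-map (to g)
      (λ v v∈C → subst (inV C) (sym (from-to g v)) v∈C)
      (λ u w e → subst₂ (inE C) (sym (from-to g u)) (sym (from-to g w)) e)
      p)

  image-delete⊆delete-image : (g : Aut X) (C : Subgraph X) (x : V) →
    _⊆_ X (image g (delete X C (from g x))) (delete X (image g C) x)
  image-delete⊆delete-image g C x =
    (λ v (v∈C , v≢x) → v∈C , v≢x ∘ cong (from g)) ,
    (λ u w (e , u≢x , w≢x) → e , u≢x ∘ cong (from g) , w≢x ∘ cong (from g))

  nonSeparable-image : (g : Aut X) (C : Subgraph X) → NonSeparable C → NonSeparable (image g C)
  nonSeparable-image g C (walk , avoid) = walk′ , avoid′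
    where
    walk′ : ∀ a b → inV C (from g a) → inV C (from g b) → Walk X (image g C) a b
    walk′ a b a∈ b∈ = Walk-image g C (walk _ _ a∈ b∈)
    avoid′ : ∀ x a b → inV C (from g a) → inV C (from g b) → a ≢ x → b ≢ x →
             ¬ ¬ Walk X (delete X (image g C) x) a b
    avoid′ x a b a∈ b∈ a≢x b≢x =
      ¬¬-map (Walk-mono (image-delete⊆delete-image g C x) ∘ Walk-image g (delete X C (from g x)))
        (avoid (from g x) _ _ a∈ b∈ (a≢x ∘ from-injective g) (b≢x ∘ from-injective g))

  _∪_ : Subgraph X → Subgraph X → Subgraph X
  B ∪ C = record
    { inV   = λ v → inV B v ⊎ inV C v
    ; inE   = λ u w → inE B u w ⊎ inE C u w
    ; E⊆~   = λ { (inj₁ e) → E⊆~ B e ; (inj₂ e) → E⊆~ C e }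
    ; E-sym = λ { (inj₁ e) → inj₁ (E-sym B e) ; (inj₂ e) → inj₂ (E-sym C e) }
    ; E⇒V   = λ { (inj₁ e) → inj₁ (E⇒V B e) ; (inj₂ e) → inj₂ (E⇒V C e) }
    }

  ⊆-∪ˡ : (B C : Subgraph X) → _⊆_ X B (B ∪ C)
  ⊆-∪ˡ B C = (λ _ → inj₁) , (λ _ _ → inj₁)

  ⊆-∪ʳ : (B C : Subgraph X) → _⊆_ X C (B ∪ C)
  ⊆-∪ʳ B C = (λ _ → inj₂) , (λ _ _ → inj₂)

  ∪-connected : (B C : Subgraph X) → NonSeparable B → NonSeparable C →
                ∀ {a} → inV B a → inV C a → Connected X (B ∪ C)
  ∪-connected B C (walkB , _) (walkC , _) {a} a∈B a∈C = (a , inj₁ a∈B) , walk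
    where
    toShared : ∀ v → inV (B ∪ C) v → Walk X (B ∪ C) v a
    toShared v (inj₁ v∈B) = Walk-mono (⊆-∪ˡ B C) (walkB v a v∈B a∈B)
    toShared v (inj₂ v∈C) = Walk-mono (⊆-∪ʳ B C) (walkC v a v∈C a∈C)
    walk : ∀ p q → inV (B ∪ C) p → inV (B ∪ C) q → Walk X (B ∪ C) p q
    walk p q p∈ q∈ = Walk-++ (toShared p p∈) (Walk-reverse (toShared q q∈))

  -- Deleting x spares one of the two shared vertices, through which both sides still connect.
  ∪-noCutvertex : (B C : Subgraph X) → NonSeparable B → NonSeparable C →
                  ∀ {a b} → a ≢ b → inV B a → inV C a → inV B b → inV C b →
                  NoCutvertex X (B ∪ C)
  ∪-noCutvertex B C (_ , avoidB) (_ , avoidC) {a} {b} a≢b a∈B a∈C b∈B b∈C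
                x (_ , p , q , (p∈ , p≢x) , (q∈ , q≢x) , ¬walk) =
    ¬¬-excluded-middle λ
      { (yes a≡x) → through b (λ b≡x → a≢b (trans a≡x (sym b≡x))) b∈B b∈C
      ; (no a≢x)  → through a a≢x a∈B a∈C
      }
    where
    through : ∀ c → c ≢ x → inV B c → inV C c → ⊥
    through c c≢x c∈B c∈C =
      toShared p p∈ p≢x λ p⇝c → toShared q q∈ q≢x λ q⇝c → ¬walk (Walk-++ p⇝c (Walk-reverse q⇝c))
      where
      toShared : ∀ v → inV (B ∪ C) v → v ≢ x → ¬ ¬ Walk X (delete X (B ∪ C) x) v c
      toShared v (inj₁ v∈B) v≢x =
        ¬¬-map (Walk-mono (delete-mono {B} {B ∪ C} (⊆-∪ˡ B C) x)) (avoidB x v c v∈B c∈B v≢x c≢x)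
      toShared v (inj₂ v∈C) v≢x =
        ¬¬-map (Walk-mono (delete-mono {C} {B ∪ C} (⊆-∪ʳ B C) x)) (avoidC x v c v∈C c∈C v≢x c≢x)

  image-⊆-of-edge : (B : Subgraph X) → IsBlock X B → (g : Aut X) →
                    ∀ {c d} → inE B c d → inE B (to g c) (to g d) → _⊆_ X (image g B) B
  image-⊆-of-edge B block@(_ , _ , maximal) g {c} {d} e ge =
    (λ v v∈gB → proj₁ B∪gB⊆B v (inj₂ v∈gB)) , (λ u w e′ → proj₂ B∪gB⊆B u w (inj₂ e′))
    where
    gB : Subgraph X
    gB = image g B
    sepB : NonSeparable B
    sepB = block⇒nonSeparable B block
    sepgB : NonSeparable gB
    sepgB = nonSeparable-image g B sepB
    gc∈gB : inV gB (to g c)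
    gc∈gB = subst (inV B) (sym (from-to g c)) (E⇒V B e)
    gd∈gB : inV gB (to g d)
    gd∈gB = subst (inV B) (sym (from-to g d)) (E⇒V B (E-sym B e))
    B∪gB⊆B : _⊆_ X (B ∪ gB) B
    B∪gB⊆B = maximal (B ∪ gB) (⊆-∪ˡ B gB)
      (∪-connected B gB sepB sepgB (E⇒V B ge) gc∈gB)
      (∪-noCutvertex B gB sepB sepgB (adjacent⇒≢ (E⊆~ B ge))
        (E⇒V B ge) gc∈gB (E⇒V B (E-sym B ge)) gd∈gB)

  stabilizes-of-edge : (B : Subgraph X) → IsBlock X B → (h : Aut X) →
                       ∀ {a b} → inE B a b → inE B (to h a) (to h b) → Stabilizes X h B
  stabilizes-of-edge B block h {a} {b} e he =
    (λ v → mk⇔ (λ v∈B → proj₁ h⁻¹B⊆B (to h v) (subst (inV B) (sym (from-to h v)) v∈B))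
               (proj₁ hB⊆B v)) ,
    (λ u w → mk⇔ (λ e′ → proj₂ h⁻¹B⊆B (to h u) (to h w)
                           (subst₂ (inE B) (sym (from-to h u)) (sym (from-to h w)) e′))
                 (proj₂ hB⊆B u w))
    where
    h⁻¹B⊆B : _⊆_ X (image h B) B
    h⁻¹B⊆B = image-⊆-of-edge B block h e he
    hB⊆B : _⊆_ X (image (invAut X h) B) B
    hB⊆B = image-⊆-of-edge B block (invAut X h) he
             (subst₂ (inE B) (sym (from-to h a)) (sym (from-to h b)) e)

  stabilizes-id : (B : Subgraph X) → Stabilizes X (idAut X) B
  stabilizes-id B = (λ _ → mk⇔ (λ p → p) (λ p → p)) , (λ _ _ → mk⇔ (λ e → e) (λ e → e))

  module _ (Γ : Aut X → Set) where

    imagesOf : (r : V) {Q : Aut X → Set} → Dec (∃ λ k → Γ k × Q k) → List V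
    imagesOf r (yes (k , _)) = to k r ∷ []
    imagesOf r (no _)        = []

    imagesOf-sound : ∀ r {Q : Aut X → Set} (d : Dec (∃ λ k → Γ k × Q k)) {x} →
                     x ∈ imagesOf r d → ∃ λ k → Γ k × Q k × x ≡ to k r
    imagesOf-sound r (yes (k , k∈Γ , Qk)) (here x≡kr) = k , k∈Γ , Qk , x≡kr

    imagesOf-complete : ∀ r {Q : Aut X → Set} (d : Dec (∃ λ k → Γ k × Q k)) → ∀ {g} → Γ g → Q g →
                        ∃ λ k → Γ k × Q k × to k r ∈ imagesOf r d
    imagesOf-complete r (yes (k , k∈Γ , Qk)) _ _ = k , k∈Γ , Qk , here refl
    imagesOf-complete r (no ∄k) g∈Γ Qg with () ← ∄k (_ , g∈Γ , Qg)

    quasiTransitive-edgeless : IsSubgroup X Γ → (B : Subgraph X) → Connected X B →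
      (∀ u w → ¬ inE B u w) → QuasiTransitiveOn X (λ g → Γ g × Stabilizes X g B) (inV B)
    quasiTransitive-edgeless sg B ((v₀ , v₀∈B) , walk) edgeless =
      v₀ ∷ [] ,
      (λ { _ (here refl) → v₀∈B }) ,
      λ v v∈B → v₀ , here refl , idAut X , (IsSubgroup.id-closed sg , stabilizes-id B) ,
                Walk-edgeless⇒≡ edgeless (walk v₀ v v₀∈B v∈B)

    module _ (decide : (P : Set) → Dec P) (locallyFinite : LocallyFinite X)
             (sg : IsSubgroup X Γ) (B : Subgraph X) (block : IsBlock X B) where

      neighbours : V → List V
      neighbours r = proj₁ (locallyFinite r)

      edgeImages : V → V → List V
      edgeImages r w = imagesOf r (decide (∃ λ k → Γ k × inE B (to k r) (to k w)))

      candidates : List V → List V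
      candidates R = concatMap (λ r → concatMap (edgeImages r) (neighbours r)) R

      ∈-candidates⁻ : ∀ R {x} → x ∈ candidates R → ∃ λ r → ∃ λ w → x ∈ edgeImages r w
      ∈-candidates⁻ R x∈ =
        let r , _ , x∈r = find (∈-concatMap⁻ (λ r → concatMap (edgeImages r) (neighbours r)) {xs = R} x∈)
            w , _ , x∈rw = find (∈-concatMap⁻ (edgeImages r) {xs = neighbours r} x∈r)
        in r , w , x∈rw

      ∈-candidates⁺ : ∀ {R r w x} → r ∈ R → w ∈ neighbours r → x ∈ edgeImages r w → x ∈ candidates R
      ∈-candidates⁺ {r = r} r∈R w∈ns x∈rw =
        ∈-concatMap⁺ (λ r → concatMap (edgeImages r) (neighbours r))
          (lose r∈R (∈-concatMap⁺ (edgeImages r) (lose w∈ns x∈rw)))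

      candidates-sound : ∀ R x → x ∈ candidates R → inV B x
      candidates-sound R x x∈ =
        let r , w , x∈rw = ∈-candidates⁻ R x∈
            k , _ , e , x≡kr = imagesOf-sound r (decide _) x∈rw
        in subst (inV B) (sym x≡kr) (E⇒V B e)

      quasiTransitive-with-edge : QuasiTransitiveOn X Γ (AllV X) → ∀ {c d} → inE B c d →
        QuasiTransitiveOn X (λ g → Γ g × Stabilizes X g B) (inV B)
      quasiTransitive-with-edge (R , _ , orbitsΓ) {c} e = candidates R , candidates-sound R , complete
        where
        complete : ∀ v → inV B v → ∃ λ x → x ∈ candidates R ×
                   ∃ λ h → (Γ h × Stabilizes X h B) × to h x ≡ v
        complete v v∈B with orbitsΓ v tt
        ... | r , r∈R , g , g∈Γ , refl with Walk-to-edge⇒edge (proj₂ (proj₁ block) _ c v∈B (E⇒V B e)) e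
        ... | u , gr-u with imagesOf-complete r (decide _) g∈Γ (subst (inE B (to g r)) (sym (to-from g u)) gr-u)
        ... | k , k∈Γ , ke , kr∈ =
          to k r , ∈-candidates⁺ r∈R (proj₂ (locallyFinite r) w r~w) kr∈ ,
          h , (h∈Γ , stabilizes-of-edge B block h ke hke) , cancel r
          where
          w : V
          w = from g u
          r~w : r ~ w
          r~w = Equivalence.from (adj g r w) (subst (to g r ~_) (sym (to-from g u)) (E⊆~ B gr-u))
          h : Aut X
          h = _∘A_ X g (invAut X k)
          h∈Γ : Γ h
          h∈Γ = IsSubgroup.∘-closed sg g∈Γ (IsSubgroup.inv-closed sg k∈Γ)
          cancel : ∀ y → to h (to k y) ≡ to g y
          cancel y = cong (to g) (from-to k y)
          hke : inE B (to h (to k r)) (to h (to k w))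
          hke = subst₂ (inE B) (sym (cancel r)) (sym (trans (cancel w) (to-from g u))) gr-u

decidable : ExcludedMiddle (Level.suc 0ℓ) → (P : Set) → Dec P
decidable em P with em {Level.Lift (Level.suc 0ℓ) P}
... | yes (lift p) = yes p
... | no ¬p        = no (¬p ∘ lift)

lemma5p2 : ExcludedMiddle (Level.suc 0ℓ) →
    (X : Graph) → ConnectedGraph X → LocallyFinite X →
    (Γ : Aut X → Set) → IsSubgroup X Γ →
    QuasiTransitiveOn X Γ (AllV X) →
    (B : Subgraph X) → IsBlock X B →
    QuasiTransitiveOn X (λ g → Γ g × Stabilizes X g B) (Subgraph.inV B)
lemma5p2 em X _ locallyFinite Γ sg qt B block
  with decidable em (∃ λ u → ∃ λ w → Subgraph.inE B u w)
... | yes (_ , _ , e) = quasiTransitive-with-edge X Γ (decidable em) locallyFinite sg B block qt e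
... | no ∄e = quasiTransitive-edgeless X Γ sg B (proj₁ block) (λ u w e → ∄e (u , w , e))
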